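{- Let $g$ be a convex geometry on a finite set $I$. For every set composition $F$ of $I$: $f^\eta_F(g)=1$ if $F\in V_g$ and $0$ otherwise; and $f^\zeta_F(g)=1$ if $F\in\mathrm{int}(V_g)$ and $0$ otherwise. Equivalently, $f^\eta_I(g)=\sum_{F\in V_g}\mathtt M_F$ and $f^\zeta_I(g)=\sum_{F\in\mathrm{int}(V_g)}\mathtt M_F$.
   Context: A convex geometry on finite $I$ is $g:2^I\to2^I$ with $A\subseteq g(A)$, $g(g(A))=g(A)$, monotone, $g(\emptyset)=\emptyset$, and anti-exchange (if $a\ne b$, $a,b\notin g(A)$, $a\in g(A\cup\{b\})$ then $b\notin g(A\cup\{a\})$). Convex sets: $g(K)=K$. For convex $A\subseteq B$, $g_{A:B}(X)=g(A\cup X)\cap(B\setminus A)$ on $B\setminus A$. Characters: $\eta_I(g)=1$; $\zeta_I(g)=1$ if $g$ is discrete ($g(X)=X$ for all $X$), else $0$. For a character $\psi$ and a set composition $F=(F_1,\dots,F_k)$ with $A_i=F_1\cup\dots\cup F_i$ ($A_0=\emptyset$), $f^\psi_F(g)=\prod_{i=1}^k\psi_{F_i}(g_{A_{i-1}:A_i})$ if all $A_i$ are convex and $f^\psi_F(g)=0$ otherwise; $f^\psi_I(g)=\sum_F f^\psi_F(g)\mathtt M_F$ in the dual of the span of set compositions, with $\{\mathtt M_F\}$ the basis dual to set compositions. $V_g$ is the set of set compositions all of whose initial unions are convex; $F\le G$ if $G$ refines $F$ by splitting blocks into ordered sub-blocks; $\mathrm{int}(V_g)=\{F\in V_g:\ G\in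 V_g\text{ for all }G\ge F\}$. -}

module Defs where

open import Data.Nat using (ℕ)
open import Data.Bool using (if_then_else_)
open import Data.Fin using (Fin)
open import Data.Fin.Subset
  using (Subset; _∈_; _∉_; _⊆_; _∪_; _∩_; _─_; ⁅_⁆; ⊥; ⊤; ⋃; Nonempty)
open import Data.Fin.Subset.Properties using (_⊆?_; anySubset?)
open import Data.Product using (Σ; _×_; _,_; proj₁; proj₂)
open import Data.List using (List; []; _∷_; _++_; map)
open import Data.Nat.ListAction using (product)
open import Data.List.Relation.Unary.All using (All; all?)
open import Data.List.Relation.Unary.AllPairs using (AllPairs)
open import Data.Vec.Properties using (≡-dec)
import Data.Bool.Properties as BoolP
open import Relation.Nullary using (Dec; yes; no; does; ¬_; ¬?)
open import Relation.Nullary.Decidable using (decidable-stable)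
open import Relation.Nullary.Decidable using (_×-dec_)
open import Relation.Binary.PropositionalEquality using (_≡_; _≢_)

_≟ˢ_ : ∀ {n} (p q : Subset n) → Dec (p ≡ q)
_≟ˢ_ = ≡-dec BoolP._≟_

record ConvexGeometry (n : ℕ) : Set where
  field
    g            : Subset n → Subset n
    extensive    : ∀ A → A ⊆ g A
    idempotent   : ∀ A → g (g A) ≡ g A
    monotone     : ∀ {A B} → A ⊆ B → g A ⊆ g B
    empty-closed : g ⊥ ≡ ⊥
    anti-exchange : ∀ A (a b : Fin n) → a ≢ b → a ∉ g A → b ∉ g A →
                    a ∈ g (A ∪ ⁅ b ⁆) → b ∉ g (A ∪ ⁅ a ⁆)

open ConvexGeometry public

IsConvex : ∀ {n} → ConvexGeometry n → Subset n → Set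
IsConvex G K = g G K ≡ K

isConvex? : ∀ {n} (G : ConvexGeometry n) (K : Subset n) → Dec (IsConvex G K)
isConvex? G K = g G K ≟ˢ K

-- A "closure-type operator on a ground set S ⊆ I": the pair (S , h),
-- with h only meaningful on subsets of S.  A character assigns a number
-- to such an object (ψ_S(h)).
Character : ℕ → Set
Character n = Subset n → (Subset n → Subset n) → ℕ

minor : ∀ {n} → ConvexGeometry n → Subset n → Subset n → Subset n → Subset n
minor G A B X = g G (A ∪ X) ∩ (B ─ A)

η : ∀ {n} → Character n
η S h = 1

Discrete : ∀ {n} → Subset n → (Subset n → Subset n) → Set
Discrete S h = ∀ X → X ⊆ S → h X ≡ X

discrete? : ∀ {n} (S : Subset n) (h : Subset n → Subset n) → Dec (Discrete S h)
discrete? S h with anySubset? (λ X → (X ⊆? S) ×-dec ¬? (h X ≟ˢ X))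
... | yes (X , X⊆S , ne) = no (λ d → ne (d X X⊆S))
... | no ¬∃ = yes (λ X X⊆S → decidable-stable (h X ≟ˢ X) (λ ne → ¬∃ (X , X⊆S , ne)))

ζ : ∀ {n} → Character n
ζ S h = if does (discrete? S h) then 1 else 0

steps : ∀ {n} → Subset n → List (Subset n) → List (Subset n × Subset n)
steps A []      = []
steps A (B ∷ F) = (A , A ∪ B) ∷ steps (A ∪ B) F

initialUnions : ∀ {n} → List (Subset n) → List (Subset n)
initialUnions F = map proj₂ (steps ⊥ F)

IsCompositionOf : ∀ {n} → Subset n → List (Subset n) → Set
IsCompositionOf B Fs =
  All Nonempty Fs × AllPairs (λ p q → p ∩ q ≡ ⊥) Fs × ⋃ Fs ≡ B

IsSetComposition : ∀ {n} → List (Subset n) → Set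
IsSetComposition = IsCompositionOf ⊤

fF : ∀ {n} → Character n → ConvexGeometry n → List (Subset n) → ℕ
fF ψ G F with all? (isConvex? G) (initialUnions F)
... | yes _ = product (map (λ AB → ψ (proj₂ AB ─ proj₁ AB)
                                     (minor G (proj₁ AB) (proj₂ AB)))
                           (steps ⊥ F))
... | no _  = 0

InV : ∀ {n} → ConvexGeometry n → List (Subset n) → Set
InV G F = All (IsConvex G) (initialUnions F)

data _≤ᶜ_ {n : ℕ} : List (Subset n) → List (Subset n) → Set where
  []   : [] ≤ᶜ []
  step : ∀ {B F G} (Gs : List (Subset n)) → IsCompositionOf B Gs →
         F ≤ᶜ G → (B ∷ F) ≤ᶜ (Gs ++ G)

InIntV : ∀ {n} → ConvexGeometry n → List (Subset n) → Set
InIntV G F = InV G F × (∀ H → F ≤ᶜ H → InV G H)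

{-# OPTIONS --safe #-}
-- On V_g, f^η_F is a product of ones and f^ζ_F is the indicator of "every minor
-- g_{A_{i-1}:A_i} is discrete", so the content is that this holds exactly on int(V_g).
-- For convex A ⊆ B the minor g_{A:B} is discrete iff every K with A ⊆ K ⊆ B is convex:
-- if A ∪ X is convex then g_{A:B}(X) = X, and conversely g(K) ⊆ g(B) = B while
-- g(K) ∖ A = g_{A:B}(K ∖ A) = K ∖ A. Refining F only inserts initial unions between
-- consecutive A_{i-1} ⊆ A_i, and splitting the block A_i ∖ A_{i-1} into X and the rest
-- makes any A_{i-1} ∪ X an initial union.
module Submission where

open import Defs
open import Data.Nat using (ℕ; _*_)
open import Data.Nat.Properties using (*-identityˡ)
open import Data.Nat.ListAction using (product)
open import Data.Bool using (if_then_else_)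
open import Data.Fin using (Fin)
open import Data.Fin.Subset using (Subset; inside; outside; _∈_; _∉_; _⊆_; _∪_; _∩_; _─_; ⊥; ⋃; Nonempty)
open import Data.Fin.Subset.Properties
open import Data.Product using (_×_; _,_; proj₂)
open import Data.Sum using ([_,_]′)
open import Data.List using (List; []; _∷_; _++_; [_]; map)
open import Data.List.Relation.Unary.All using (All; []; _∷_; all?; head; tail)
open import Data.List.Relation.Unary.AllPairs using ([]; _∷_)
open import Data.Vec.Base using (_∷_; here; there)
open import Function using (id; _∘_; _⇔_; mk⇔; Equivalence)
open import Relation.Nullary using (Dec; yes; no; does; ¬_; contradiction)
open import Relation.Nullary.Decidable using (_×-dec_; dec-true; dec-false)
open import Relation.Unary using (Decidable)
open import Relation.Binary.PropositionalEquality
  using (_≡_; refl; sym; trans; cong; subst; module ≡-Reasoning)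

private
  variable
    n : ℕ
    x : Fin n
    p q r : Subset n
    A B C D X : Subset n
    F H Gs : List (Subset n)

x∈p─q⁻ : x ∈ p ─ q → x ∈ p × x ∉ q
x∈p─q⁻ {p = p} {q = q} x∈p─q = p─q⊆p p q x∈p─q , x∉q p q x∈p─q
  where
  x∉q : ∀ {n} {x : Fin n} (p q : Subset n) → x ∈ p ─ q → x ∉ q
  x∉q (_ ∷ p) (_ ∷ q) (there x∈p─q) (there x∈q) = x∉q p q x∈p─q x∈q
  x∉q (inside ∷ _) (inside ∷ _) () here
  x∉q (outside ∷ _) (inside ∷ _) () here

p∪[q─p]≡q : p ⊆ q → p ∪ (q ─ p) ≡ q
p∪[q─p]≡q {p = p} {q = q} p⊆q = ⊆-antisym
  (λ x∈p∪[q─p] → [ p⊆q , p─q⊆p q p ]′ (x∈p∪q⁻ p (q ─ p) x∈p∪[q─p]))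
  q⊆p∪[q─p]
  where
  q⊆p∪[q─p] : q ⊆ p ∪ (q ─ p)
  q⊆p∪[q─p] {x} x∈q with x ∈? p
  ... | yes x∈p = p⊆p∪q (q ─ p) x∈p
  ... | no x∉p  = q⊆p∪q p (q ─ p) (x∈p∧x∉q⇒x∈p─q x∈q x∉p)

[p∪q]─p⊆q : (p ∪ q) ─ p ⊆ q
[p∪q]─p⊆q {p = p} {q = q} x∈[p∪q]─p with x∈p─q⁻ x∈[p∪q]─p
... | x∈p∪q , x∉p = [ (λ x∈p → contradiction x∈p x∉p) , id ]′ (x∈p∪q⁻ p q x∈p∪q)

p∩[q─p]≡⊥ : p ∩ (q ─ p) ≡ ⊥
p∩[q─p]≡⊥ {p = p} {q = q} = ⊆-antisym p∩[q─p]⊆⊥ ⊥⊆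
  where
  p∩[q─p]⊆⊥ : p ∩ (q ─ p) ⊆ ⊥
  p∩[q─p]⊆⊥ x∈ with x∈p∩q⁻ p (q ─ p) x∈
  ... | x∈p , x∈q─p = contradiction x∈p (proj₂ (x∈p─q⁻ x∈q─p))

[p∪q]∩[r─p]≡q : q ⊆ r ─ p → (p ∪ q) ∩ (r ─ p) ≡ q
[p∪q]∩[r─p]≡q {q = q} {r = r} {p = p} q⊆r─p = ⊆-antisym
  [p∪q]∩[r─p]⊆q
  (λ x∈q → x∈p∩q⁺ (q⊆p∪q p q x∈q , q⊆r─p x∈q))
  where
  [p∪q]∩[r─p]⊆q : (p ∪ q) ∩ (r ─ p) ⊆ q
  [p∪q]∩[r─p]⊆q x∈ with x∈p∩q⁻ (p ∪ q) (r ─ p) x∈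
  ... | x∈p∪q , x∈r─p =
    [ (λ x∈p → contradiction x∈p (proj₂ (x∈p─q⁻ x∈r─p))) , id ]′ (x∈p∪q⁻ p q x∈p∪q)

singleton-composition : Nonempty B → IsCompositionOf B [ B ]
singleton-composition B≢∅ = B≢∅ ∷ [] , [] ∷ [] , ∪-identityʳ _

two-block-composition : X ⊆ B → Nonempty X → Nonempty (B ─ X) →
                        IsCompositionOf B (X ∷ (B ─ X) ∷ [])
two-block-composition {X = X} X⊆B X≢∅ B─X≢∅ =
  X≢∅ ∷ B─X≢∅ ∷ [] , (p∩[q─p]≡⊥ ∷ []) ∷ [] ∷ [] ,
  trans (cong (X ∪_) (∪-identityʳ _)) (p∪[q─p]≡q X⊆B)

≤ᶜ-refl : All Nonempty F → F ≤ᶜ F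
≤ᶜ-refl []          = []
≤ᶜ-refl (B≢∅ ∷ F≢∅) = step _ (singleton-composition B≢∅) (≤ᶜ-refl F≢∅)

indicator : {P : Set} → Dec P → ℕ
indicator P? = if does P? then 1 else 0

indicator-yes : {P : Set} (P? : Dec P) → P → indicator P? ≡ 1
indicator-yes P? p rewrite dec-true P? p = refl

indicator-no : {P : Set} (P? : Dec P) → ¬ P → indicator P? ≡ 0
indicator-no P? ¬p rewrite dec-false P? ¬p = refl

indicator-×-dec : {P Q : Set} (P? : Dec P) (Q? : Dec Q) →
                  indicator (P? ×-dec Q?) ≡ indicator P? * indicator Q?
indicator-×-dec (yes _) Q? = sym (*-identityˡ (indicator Q?))
indicator-×-dec (no _)  Q? = refl

product-indicator : {T : Set} {P : T → Set} (P? : Decidable P) (xs : List T) →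
                    product (map (indicator ∘ P?) xs) ≡ indicator (all? P? xs)
product-indicator P? []       = refl
product-indicator P? (x ∷ xs) = begin
  indicator (P? x) * product (map (indicator ∘ P?) xs)
    ≡⟨ cong (indicator (P? x) *_) (product-indicator P? xs) ⟩
  indicator (P? x) * indicator (all? P? xs)
    ≡⟨ indicator-×-dec (P? x) (all? P? xs) ⟨
  indicator (all? P? (x ∷ xs))
    ∎
  where open ≡-Reasoning

product-map-1 : {T : Set} (xs : List T) → product (map (λ _ → 1) xs) ≡ 1
product-map-1 []       = refl
product-map-1 (_ ∷ xs) = cong (1 *_) (product-map-1 xs)

module _ (G : ConvexGeometry n) where

  ConvexChain : Subset n → List (Subset n) → Set
  ConvexChain A F = All (IsConvex G) (map proj₂ (steps A F))

  RefinementsConvex : Subset n → List (Subset n) → Set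
  RefinementsConvex A F = ∀ H → F ≤ᶜ H → ConvexChain A H

  IntervalConvex : Subset n → Subset n → Set
  IntervalConvex A C = ∀ {K} → A ⊆ K → K ⊆ C → IsConvex G K

  DiscreteMinor : Subset n × Subset n → Set
  DiscreteMinor (A , C) = Discrete (C ─ A) (minor G A C)

  discreteMinor? : Decidable DiscreteMinor
  discreteMinor? (A , C) = discrete? (C ─ A) (minor G A C)

  minor-fixes-convex : IsConvex G (A ∪ X) → X ⊆ C ─ A → minor G A C X ≡ X
  minor-fixes-convex {A = A} {X = X} {C = C} A∪X-convex X⊆C─A = begin
    g G (A ∪ X) ∩ (C ─ A) ≡⟨ cong (_∩ (C ─ A)) A∪X-convex ⟩
    (A ∪ X) ∩ (C ─ A)     ≡⟨ [p∪q]∩[r─p]≡q X⊆C─A ⟩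
    X                     ∎
    where open ≡-Reasoning

  discreteMinor⇒intervalConvex : IsConvex G C → DiscreteMinor (A , C) → IntervalConvex A C
  discreteMinor⇒intervalConvex {C = C} {A = A} C-convex discrete {K} A⊆K K⊆C =
    ⊆-antisym gK⊆K (extensive G K)
    where
    K─A⊆C─A : K ─ A ⊆ C ─ A
    K─A⊆C─A x∈K─A with x∈p─q⁻ x∈K─A
    ... | x∈K , x∉A = x∈p∧x∉q⇒x∈p─q (K⊆C x∈K) x∉A
    gK⊆K : g G K ⊆ K
    gK⊆K {x} x∈gK with x ∈? A
    ... | yes x∈A = A⊆K x∈A
    ... | no x∉A  = p─q⊆p K A (subst (x ∈_) (discrete (K ─ A) K─A⊆C─A) x∈minor)
      where
      x∈minor : x ∈ minor G A C (K ─ A)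
      x∈minor = x∈p∩q⁺
        ( subst (λ Z → x ∈ g G Z) (sym (p∪[q─p]≡q A⊆K)) x∈gK
        , x∈p∧x∉q⇒x∈p─q (subst (x ∈_) C-convex (monotone G K⊆C x∈gK)) x∉A )

  intervalConvex⇒convexChain-++ : IntervalConvex A D → A ⊆ C → C ∪ ⋃ Gs ≡ D →
                                  ConvexChain D H → ConvexChain C (Gs ++ H)
  intervalConvex⇒convexChain-++ {C = C} {Gs = []} {H = H} _ _ C∪⊥≡D chain =
    subst (λ Z → ConvexChain Z H) (trans (sym C∪⊥≡D) (∪-identityʳ C)) chain
  intervalConvex⇒convexChain-++ {C = C} {Gs = X ∷ Gs} interval A⊆C C∪X∪⋃Gs≡D chain =
    interval A⊆C∪X C∪X⊆D ∷ intervalConvex⇒convexChain-++ interval A⊆C∪X [C∪X]∪⋃Gs≡D chain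
    where
    A⊆C∪X : _ ⊆ C ∪ X
    A⊆C∪X x∈A = p⊆p∪q X (A⊆C x∈A)
    [C∪X]∪⋃Gs≡D : (C ∪ X) ∪ ⋃ Gs ≡ _
    [C∪X]∪⋃Gs≡D = trans (∪-assoc C X (⋃ Gs)) C∪X∪⋃Gs≡D
    C∪X⊆D : C ∪ X ⊆ _
    C∪X⊆D x∈C∪X = subst (_ ∈_) [C∪X]∪⋃Gs≡D (p⊆p∪q (⋃ Gs) x∈C∪X)

  discreteMinors⇒refinementsConvex : ConvexChain A F → All DiscreteMinor (steps A F) →
                                     RefinementsConvex A F
  discreteMinors⇒refinementsConvex _ _ .[] [] = []
  discreteMinors⇒refinementsConvex {A = A} (A∪B-convex ∷ chain) (discrete ∷ discretes)
    .(Gs ++ H) (step {G = H} Gs (_ , _ , ⋃Gs≡B) F≤H) =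
    intervalConvex⇒convexChain-++
      (discreteMinor⇒intervalConvex A∪B-convex discrete) ⊆-refl (cong (A ∪_) ⋃Gs≡B)
      (discreteMinors⇒refinementsConvex chain discretes H F≤H)

  refinementsConvex⇒convex-∪ : IsConvex G A → All Nonempty (B ∷ F) →
                               RefinementsConvex A (B ∷ F) → X ⊆ B → IsConvex G (A ∪ X)
  refinementsConvex⇒convex-∪ {A = A} {B = B} {X = X} A-convex (B≢∅ ∷ F≢∅) refinements X⊆B
    with nonempty? X | nonempty? (B ─ X)
  ... | no X≡∅ | _ =
    subst (IsConvex G) (sym (trans (cong (A ∪_) (Empty-unique X≡∅)) (∪-identityʳ A))) A-convex
  ... | yes X≢∅ | yes B─X≢∅ =
    head (refinements _ (step _ (two-block-composition X⊆B X≢∅ B─X≢∅) (≤ᶜ-refl F≢∅)))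
  ... | yes _ | no B─X≡∅ =
    subst (λ Z → IsConvex G (A ∪ Z)) (sym X≡B) (head (refinements _ (≤ᶜ-refl (B≢∅ ∷ F≢∅))))
    where
    open ≡-Reasoning
    X≡B : X ≡ B
    X≡B = begin
      X             ≡⟨ ∪-identityʳ X ⟨
      X ∪ ⊥         ≡⟨ cong (X ∪_) (Empty-unique B─X≡∅) ⟨
      X ∪ (B ─ X)   ≡⟨ p∪[q─p]≡q X⊆B ⟩
      B             ∎

  refinementsConvex⇒discreteMinors : IsConvex G A → All Nonempty F → RefinementsConvex A F →
                                     All DiscreteMinor (steps A F)
  refinementsConvex⇒discreteMinors _ [] _ = []
  refinementsConvex⇒discreteMinors {A = A} {F = B ∷ F} A-convex (B≢∅ ∷ F≢∅) refinements =
    discrete ∷ refinementsConvex⇒discreteMinors A∪B-convex F≢∅ tail-refinements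
    where
    discrete : DiscreteMinor (A , A ∪ B)
    discrete X X⊆ = minor-fixes-convex
      (refinementsConvex⇒convex-∪ A-convex (B≢∅ ∷ F≢∅) refinements (λ x∈X → [p∪q]─p⊆q (X⊆ x∈X)))
      X⊆
    A∪B-convex : IsConvex G (A ∪ B)
    A∪B-convex = head (refinements _ (≤ᶜ-refl (B≢∅ ∷ F≢∅)))
    tail-refinements : RefinementsConvex (A ∪ B) F
    tail-refinements H F≤H = tail (refinements (B ∷ H) (step [ B ] (singleton-composition B≢∅) F≤H))

  interior⇔discreteMinors : All Nonempty F → InIntV G F ⇔ (InV G F × All DiscreteMinor (steps ⊥ F))
  interior⇔discreteMinors F≢∅ = mk⇔
    (λ (inV , refinements) → inV , refinementsConvex⇒discreteMinors (empty-closed G) F≢∅ refinements)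
    (λ (inV , discretes) → inV , discreteMinors⇒refinementsConvex inV discretes)

  inV? : (F : List (Subset n)) → Dec (InV G F)
  inV? F = all? (isConvex? G) (initialUnions F)

  inV×discreteMinors? : (F : List (Subset n)) → Dec (InV G F × All DiscreteMinor (steps ⊥ F))
  inV×discreteMinors? F = inV? F ×-dec all? discreteMinor? (steps ⊥ F)

  fF-η : (F : List (Subset n)) → fF η G F ≡ indicator (inV? F)
  fF-η F with inV? F
  ... | yes _ = product-map-1 (steps ⊥ F)
  ... | no _  = refl

  fF-ζ : (F : List (Subset n)) → fF ζ G F ≡ indicator (inV×discreteMinors? F)
  fF-ζ F with inV? F
  ... | yes _ = product-indicator discreteMinor? (steps ⊥ F)
  ... | no _  = refl

mainTheorem13 : ∀ (n : ℕ) (G : ConvexGeometry n) (F : List (Subset n)) →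
    IsSetComposition F →
    ((InV G F → fF η G F ≡ 1) × (¬ InV G F → fF η G F ≡ 0)) ×
    ((InIntV G F → fF ζ G F ≡ 1) × (¬ InIntV G F → fF ζ G F ≡ 0))
mainTheorem13 n G F (F≢∅ , _ , _) =
    ( (λ inV → trans (fF-η G F) (indicator-yes (inV? G F) inV))
    , (λ ¬inV → trans (fF-η G F) (indicator-no (inV? G F) ¬inV)) )
  , ( (λ inInt → trans (fF-ζ G F) (indicator-yes (inV×discreteMinors? G F) (to inInt)))
    , (λ ¬inInt → trans (fF-ζ G F) (indicator-no (inV×discreteMinors? G F) (¬inInt ∘ from))) )
  where open Equivalence (interior⇔discreteMinors G F≢∅)
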